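{- Let $d\ge 1$. Any separator of cardinality $d$ in the graph of the $d$-cube is an independent set.
   Context: A set $S$ of vertices of a graph is a separator if there are two vertices $a,b\notin S$ such that every path from $a$ to $b$ contains a vertex of $S$. A set of vertices is independent if no two of its elements are adjacent. -}

module Defs where

open import Data.Nat using (ℕ; suc)
open import Data.Bool using (Bool)
open import Data.Fin using (Fin)
open import Data.Vec using (Vec; lookup)
open import Data.List using (List; []; _∷_; length)
open import Data.List.Membership.Propositional using (_∈_; _∉_)
open import Data.List.Relation.Unary.Unique.Propositional using (Unique)
open import Data.List.Relation.Unary.Any using (Any)
open import Data.Product using (Σ; ∃; _×_; ∃-syntax)
open import Relation.Binary.PropositionalEquality using (_≡_; _≢_)
open import Relation.Nullary using (¬_)

Vertex : ℕ → Set
Vertex d = Vec Bool d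

Adj : ∀ {d} → Vertex d → Vertex d → Set
Adj {d} u v = ∃[ i ] (lookup u i ≢ lookup v i ×
                      ((j : Fin d) → j ≢ i → lookup u j ≡ lookup v j))

data WalkFrom {d : ℕ} : Vertex d → Vertex d → List (Vertex d) → Set where
  single : ∀ a → WalkFrom a a (a ∷ [])
  step   : ∀ {a c b vs} → Adj a c → WalkFrom c b vs → WalkFrom a b (a ∷ vs)

IsPath : ∀ {d} → Vertex d → Vertex d → List (Vertex d) → Set
IsPath a b vs = WalkFrom a b vs × Unique vs

IsSeparator : ∀ {d} → List (Vertex d) → Set
IsSeparator {d} S =
  ∃[ a ] ∃[ b ] (a ∉ S × b ∉ S ×
    ((vs : List (Vertex d)) → IsPath a b vs → Any (λ v → v ∈ S) vs))

IsIndependent : ∀ {d} → List (Vertex d) → Set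
IsIndependent S = ∀ {u v} → u ∈ S → v ∈ S → ¬ Adj u v

module Submission where

-- We prove the contrapositive in connectivity form: if S is a set of at most
-- d vertices containing an edge, then Q_d − S is connected
-- (`edge-removal-connected`), so S cannot separate any two vertices.  The
-- companion bound `small-removal-connected` says that removing fewer than d
-- vertices, or at most one, never disconnects Q_d.
--
-- Q_{d+1} consists of two layers
-- {x ∷ v | v ∈ Q_d} (x = false, true) joined by the edges x ∷ v — y ∷ v, and
-- S splits into two slices, one per layer.  Connectivity of Q_{d+1} − S is
-- assembled by two gluing lemmas: either one layer minus S is connected and
-- its slice lies inside every slice, so every vertex steps straight into
-- that layer (`connected-via-layer`); or both layers minus S are connected
-- and, since |S| < 2^d, some column avoids S and links them
-- (`connected-via-halves`).  Finally a walk avoiding S is shortened to a path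
-- avoiding S, contradicting the separator property.

open import Defs
open import Data.Nat using (ℕ; _≥_; _≤_)
open import Data.List using (List; length)
open import Data.List.Relation.Unary.Unique.Propositional using (Unique)
open import Relation.Binary.PropositionalEquality using (_≡_)

open import Data.Nat using (zero; suc; _+_; _<_; _^_; z≤n; s≤s; _<?_; _≤?_)
open import Data.Nat.Properties
  using ( +-comm; +-suc; +-identityʳ; +-mono-≤; +-monoʳ-<; +-cancelʳ-<; m^n>0
        ; ≤-reflexive; ≤-trans; ≤-pred; m≤n⇒m≤1+n; n≤1+n; <⇒≱; ≮⇒≥; ≰⇒>; 1+n≰n
        ; module ≤-Reasoning )
open import Data.Bool using (Bool; true; false; not)
open import Data.Bool.Properties using (not-¬)
import Data.Bool.Properties as Bool
open import Data.Fin using (zero; suc)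
open import Data.Fin.Properties using (suc-injective)
open import Data.Vec using ([]; _∷_; lookup)
open import Data.Vec.Properties using (≡-dec; tabulate∘lookup; tabulate-cong)
open import Data.List using ([]; _∷_; _++_)
open import Data.List.Properties using (length-++)
open import Data.List.Membership.Propositional using (_∈_; _∉_)
open import Data.List.Membership.Propositional.Properties using (∈-++⁺ˡ; ∈-++⁺ʳ)
import Data.List.Membership.DecPropositional as DecMembership
open import Data.List.Relation.Unary.Any using (here; there)
open import Data.List.Relation.Unary.Any.Properties using (¬Any[])
open import Data.List.Relation.Unary.All using (All; []; _∷_)
open import Data.List.Relation.Unary.All.Properties using (¬Any⇒All¬; All¬⇒¬Any)
open import Data.List.Relation.Unary.AllPairs using ([]; _∷_)
open import Data.Product using (∃; _×_; _,_)
open import Data.Sum using (_⊎_; inj₁; inj₂; [_,_]′)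
open import Data.Empty using (⊥; ⊥-elim)
open import Function using (_∘_)
open import Relation.Nullary using (Dec; yes; no)
open import Relation.Binary.PropositionalEquality
  using (refl; sym; trans; cong; subst; _≢_; ≢-sym)

every-bit : ∀ {ℓ} {P : Bool → Set ℓ} {x y} → x ≢ y → P x → P y → ∀ z → P z
every-bit {x = false} {false} x≢y _ _ _ = ⊥-elim (x≢y refl)
every-bit {x = false} {true}  _ px py false = px
every-bit {x = false} {true}  _ px py true  = py
every-bit {x = true}  {false} _ px py false = py
every-bit {x = true}  {false} _ px py true  = px
every-bit {x = true}  {true}  x≢y _ _ _ = ⊥-elim (x≢y refl)

empty-or-nonempty : ∀ {A : Set} (L : List A) → L ≡ [] ⊎ 1 ≤ length L
empty-or-nonempty []      = inj₁ refl
empty-or-nonempty (_ ∷ _) = inj₂ (s≤s z≤n)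

two-members : ∀ {A : Set} {L : List A} {u v} → u ∈ L → v ∈ L → u ≢ v → 2 ≤ length L
two-members (here refl) (here refl) u≢v = ⊥-elim (u≢v refl)
two-members {L = _ ∷ _ ∷ _} (here refl) (there _) _ = s≤s (s≤s z≤n)
two-members {L = _ ∷ _ ∷ _} (there _) (here refl) _ = s≤s (s≤s z≤n)
two-members (there u∈) (there v∈) u≢v = m≤n⇒m≤1+n (two-members u∈ v∈ u≢v)

at-most-one : ∀ {A : Set} {L : List A} {u v} → length L ≤ 1 → u ∈ L → v ∈ L → v ≡ u
at-most-one {L = _ ∷ []} _ (here refl) (here refl) = refl
at-most-one {L = _ ∷ _ ∷ _} (s≤s ()) _ _

2^suc : ∀ n → 2 ^ suc n ≡ 2 ^ n + 2 ^ n
2^suc n = cong (2 ^ n +_) (+-identityʳ (2 ^ n))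

n<2^n : ∀ n → n < 2 ^ n
n<2^n zero    = s≤s z≤n
n<2^n (suc n) = begin
  1 + suc n       ≤⟨ +-mono-≤ (m^n>0 2 n) (n<2^n n) ⟩
  2 ^ n + 2 ^ n   ≡⟨ 2^suc n ⟨
  2 ^ suc n       ∎
  where open ≤-Reasoning

suc-n<2^n : ∀ n → 2 ≤ n → suc n < 2 ^ n
suc-n<2^n (suc zero) (s≤s ())
suc-n<2^n (suc m@(suc _)) _ = begin
  2 + suc m       ≤⟨ +-mono-≤ (≤-trans (s≤s (s≤s z≤n)) (n<2^n m)) (n<2^n m) ⟩
  2 ^ m + 2 ^ m   ≡⟨ 2^suc m ⟨
  2 ^ suc m       ∎
  where open ≤-Reasoning

-- The counting condition for a free column in the inductive step of
-- `edge-removal-connected`: 3 ≤ n ≤ d + 1 forces d ≥ 2, hence n ≤ d + 1 < 2^d.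
room-for-column : ∀ {n d} → 3 ≤ n → n ≤ suc d → n < 2 ^ d
room-for-column {d = d} 3≤n n≤1+d =
  ≤-trans (s≤s n≤1+d) (suc-n<2^n d (≤-pred (≤-trans 3≤n n≤1+d)))

adj-irrefl : ∀ {d} {u v : Vertex d} → Adj u v → u ≢ v
adj-irrefl (_ , differ , _) refl = differ refl

no-edges-in-Q₀ : ∀ {u v : Vertex 0} → Adj u v → ⊥
no-edges-in-Q₀ (() , _)

adj-within : ∀ {d} (x : Bool) {u v : Vertex d} → Adj u v → Adj (x ∷ u) (x ∷ v)
adj-within x {u} {v} (i , differ , agree) = suc i , differ , agree′
  where
  agree′ : ∀ j → j ≢ suc i → lookup (x ∷ u) j ≡ lookup (x ∷ v) j
  agree′ zero    _      = refl
  agree′ (suc j) j≢suc = agree j (j≢suc ∘ cong suc)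

adj-across : ∀ {d} {x y : Bool} (w : Vertex d) → x ≢ y → Adj (x ∷ w) (y ∷ w)
adj-across {x = x} {y} w x≢y = zero , x≢y , agree
  where
  agree : ∀ j → j ≢ zero → lookup (x ∷ w) j ≡ lookup (y ∷ w) j
  agree zero    j≢0 = ⊥-elim (j≢0 refl)
  agree (suc j) _   = refl

adj-cases : ∀ {d} {x y : Bool} {u v : Vertex d} → Adj (x ∷ u) (y ∷ v) →
            (x ≡ y × Adj u v) ⊎ (x ≢ y × u ≡ v)
adj-cases {u = u} {v} (zero , x≢y , agree) =
  inj₂ (x≢y , vec-ext (λ j → agree (suc j) λ ()))
  where
  vec-ext : (∀ j → lookup u j ≡ lookup v j) → u ≡ v
  vec-ext same = trans (sym (tabulate∘lookup u))
                       (trans (tabulate-cong same) (tabulate∘lookup v))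
adj-cases (suc i , differ , agree) =
  inj₁ (agree zero (λ ()) , i , differ , λ j j≢i → agree (suc j) (j≢i ∘ suc-injective))

-- Connectivity of the cube with a set of vertices removed

-- `Reach S a b`: b is reached from a by a walk whose vertices after a avoid S.
data Reach {d} (S : List (Vertex d)) : Vertex d → Vertex d → Set where
  stay : ∀ a → Reach S a a
  move : ∀ {a c b} → Adj a c → c ∉ S → Reach S c b → Reach S a b

reach-trans : ∀ {d} {S : List (Vertex d)} {a b c} → Reach S a b → Reach S b c → Reach S a c
reach-trans (stay _)          r′ = r′
reach-trans (move a~c c∉S r) r′ = move a~c c∉S (reach-trans r r′)

Connected : ∀ {d} → List (Vertex d) → Set
Connected {d} S = ∀ {a b : Vertex d} → a ∉ S → b ∉ S → Reach S a b

slice : ∀ {d} → Bool → List (Vertex (suc d)) → List (Vertex d)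
slice x [] = []
slice false ((false ∷ v) ∷ S) = v ∷ slice false S
slice false ((true  ∷ v) ∷ S) = slice false S
slice true  ((false ∷ v) ∷ S) = slice true S
slice true  ((true  ∷ v) ∷ S) = v ∷ slice true S

∈-slice⁺ : ∀ {d} (x : Bool) {v : Vertex d} S → (x ∷ v) ∈ S → v ∈ slice x S
∈-slice⁺ false ((false ∷ _) ∷ S) (here refl) = here refl
∈-slice⁺ true  ((true  ∷ _) ∷ S) (here refl) = here refl
∈-slice⁺ false ((false ∷ _) ∷ S) (there m) = there (∈-slice⁺ false S m)
∈-slice⁺ false ((true  ∷ _) ∷ S) (there m) = ∈-slice⁺ false S m
∈-slice⁺ true  ((false ∷ _) ∷ S) (there m) = ∈-slice⁺ true S m
∈-slice⁺ true  ((true  ∷ _) ∷ S) (there m) = there (∈-slice⁺ true S m)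

∈-slice⁻ : ∀ {d} (x : Bool) {v : Vertex d} S → v ∈ slice x S → (x ∷ v) ∈ S
∈-slice⁻ false ((false ∷ _) ∷ S) (here refl) = here refl
∈-slice⁻ false ((false ∷ _) ∷ S) (there m)   = there (∈-slice⁻ false S m)
∈-slice⁻ false ((true  ∷ _) ∷ S) m           = there (∈-slice⁻ false S m)
∈-slice⁻ true  ((false ∷ _) ∷ S) m           = there (∈-slice⁻ true S m)
∈-slice⁻ true  ((true  ∷ _) ∷ S) (here refl) = here refl
∈-slice⁻ true  ((true  ∷ _) ∷ S) (there m)   = there (∈-slice⁻ true S m)

slice-sizes : ∀ {d} (S : List (Vertex (suc d))) →
              length (slice false S) + length (slice true S) ≡ length S
slice-sizes [] = refl
slice-sizes ((false ∷ _) ∷ S) = cong suc (slice-sizes S)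
slice-sizes ((true  ∷ _) ∷ S) =
  trans (+-suc (length (slice false S)) _) (cong suc (slice-sizes S))

slice-sizes′ : ∀ {d} (S : List (Vertex (suc d))) {x y} → x ≢ y →
               length (slice x S) + length (slice y S) ≡ length S
slice-sizes′ S {false} {false} x≢y = ⊥-elim (x≢y refl)
slice-sizes′ S {false} {true}  _   = slice-sizes S
slice-sizes′ S {true}  {false} _   =
  trans (+-comm (length (slice true S)) _) (slice-sizes S)
slice-sizes′ S {true}  {true}  x≢y = ⊥-elim (x≢y refl)

slices-lower : ∀ {d m n} (S : List (Vertex (suc d))) {x y} → x ≢ y →
               m ≤ length (slice x S) → n ≤ length (slice y S) → m + n ≤ length S
slices-lower S x≢y m≤ n≤ = ≤-trans (+-mono-≤ m≤ n≤) (≤-reflexive (slice-sizes′ S x≢y))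

other-slice-< : ∀ {d c j} (S : List (Vertex (suc d))) {x y} → x ≢ y →
                length S ≤ j + c → j < length (slice y S) → length (slice x S) < c
other-slice-< {c = c} {j} S {x} {y} x≢y |S|≤ j< = +-cancelʳ-< j (length (slice x S)) c (begin-strict
  length (slice x S) + j                    <⟨ +-monoʳ-< (length (slice x S)) j< ⟩
  length (slice x S) + length (slice y S)   ≡⟨ slice-sizes′ S x≢y ⟩
  length S                                  ≤⟨ |S|≤ ⟩
  j + c                                     ≡⟨ +-comm j c ⟩
  c + j                                     ∎)
  where open ≤-Reasoning

reach-lift : ∀ {d} (x : Bool) (S : List (Vertex (suc d))) {u v} →
             Reach (slice x S) u v → Reach S (x ∷ u) (x ∷ v)
reach-lift x S (stay _)          = stay _
reach-lift x S (move u~c c∉ r)   = move (adj-within x u~c) (c∉ ∘ ∈-slice⁺ x S) (reach-lift x S r)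

reach-across : ∀ {d} (S : List (Vertex (suc d))) {x y} {a : Vertex d} →
               (y ∷ a) ∉ S → Reach S (x ∷ a) (y ∷ a)
reach-across S {x} {y} ya∉S with x Bool.≟ y
... | yes refl = stay _
... | no x≢y   = move (adj-across _ x≢y) ya∉S (stay _)

-- Gluing, first form: if layer y minus S is connected and slice y lies in
-- every slice, each vertex outside S enters layer y along its column.
connected-via-layer : ∀ {d} (S : List (Vertex (suc d))) (y : Bool) →
                      Connected (slice y S) →
                      (∀ x {v} → v ∈ slice y S → v ∈ slice x S) → Connected S
connected-via-layer S y layer ⊆every {x ∷ a} {z ∷ b} xa∉S zb∉S =
  reach-trans (reach-across S (enter xa∉S))
    (reach-trans (reach-lift y S (layer (enter xa∉S ∘ ∈-slice⁻ y S) (enter zb∉S ∘ ∈-slice⁻ y S)))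
      (reach-across S zb∉S))
  where
  enter : ∀ {x c} → (x ∷ c) ∉ S → (y ∷ c) ∉ S
  enter {x} xc∉S yc∈S = xc∉S (∈-slice⁻ x S (⊆every x (∈-slice⁺ y S yc∈S)))

cube-connected : ∀ d → Connected {d} []
cube-connected zero    {[]} {[]} _ _ = stay []
cube-connected (suc d) = connected-via-layer [] false (cube-connected d) (λ _ ())

-- A layer untouched by S serves as the funnel.
connected-via-free-layer : ∀ {d} (S : List (Vertex (suc d))) (y : Bool) →
                           slice y S ≡ [] → Connected S
connected-via-free-layer S y empty =
  connected-via-layer S y (subst Connected (sym empty) (cube-connected _))
    (λ _ v∈ → ⊥-elim (¬Any[] (subst (_ ∈_) empty v∈)))

missed-vertex : ∀ n (L : List (Vertex n)) → length L < 2 ^ n → ∃ λ v → v ∉ L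
missed-vertex zero [] _ = [] , λ ()
missed-vertex zero (_ ∷ _) (s≤s ())
missed-vertex (suc n) L short
  with length (slice false L) <? 2 ^ n | length (slice true L) <? 2 ^ n
... | yes p | _ = let v , v∉ = missed-vertex n _ p in false ∷ v , v∉ ∘ ∈-slice⁺ false L
... | no _ | yes q = let v , v∉ = missed-vertex n _ q in true ∷ v , v∉ ∘ ∈-slice⁺ true L
... | no p | no q = ⊥-elim (<⇒≱ short (begin
  2 ^ suc n                                     ≡⟨ 2^suc n ⟩
  2 ^ n + 2 ^ n                                 ≤⟨ +-mono-≤ (≮⇒≥ p) (≮⇒≥ q) ⟩
  length (slice false L) + length (slice true L) ≡⟨ slice-sizes L ⟩
  length L                                      ∎))
  where open ≤-Reasoning

free-column : ∀ {d} (S : List (Vertex (suc d))) → length S < 2 ^ d →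
              ∃ λ w → ∀ z → w ∉ slice z S
free-column {d} S short with missed-vertex d (slice false S ++ slice true S) short′
  where
  short′ = ≤-trans (s≤s (≤-reflexive (trans (length-++ (slice false S)) (slice-sizes S)))) short
... | w , w∉ = w , λ where
  false w∈ → w∉ (∈-++⁺ˡ w∈)
  true  w∈ → w∉ (∈-++⁺ʳ (slice false S) w∈)

-- Gluing, second form: both layers minus S connected, linked by a free column.
connected-via-halves : ∀ {d} (S : List (Vertex (suc d))) →
                       (∀ z → Connected (slice z S)) → length S < 2 ^ d → Connected S
connected-via-halves S halves short {x ∷ a} {z ∷ b} xa∉S zb∉S with free-column S short
... | w , w∉ =
  reach-trans (reach-lift x S (halves x (xa∉S ∘ ∈-slice⁻ x S) (w∉ x)))
    (reach-trans (reach-across S (w∉ z ∘ ∈-slice⁺ z S))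
      (reach-lift z S (halves z (w∉ z) (zb∉S ∘ ∈-slice⁻ z S))))

small-removal-connected : ∀ d (S : List (Vertex d)) → length S < d ⊎ length S ≤ 1 →
                          Connected S
small-removal-connected zero S _ {[]} {[]} _ _ = stay []
small-removal-connected (suc d) S small
  with empty-or-nonempty (slice false S) | empty-or-nonempty (slice true S)
... | inj₁ empty | _          = connected-via-free-layer S false empty
... | inj₂ _     | inj₁ empty = connected-via-free-layer S true empty
... | inj₂ ne₀   | inj₂ ne₁   = connected-via-halves S halves (≤-trans (s≤s |S|≤d) (n<2^n d))
  where
  -- both slices are inhabited, so |S| ≥ 2 and the first alternative holds
  |S|≤d : length S ≤ d
  |S|≤d = [ ≤-pred , (λ ≤1 → ⊥-elim (1+n≰n (≤-trans (slices-lower S (λ ()) ne₀ ne₁) ≤1))) ]′ small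
  halves : ∀ z → Connected (slice z S)
  halves = every-bit {x = false} {true} (λ ())
    (small-removal-connected d _ (inj₁ (other-slice-< S (λ ()) |S|≤d ne₁)))
    (small-removal-connected d _ (inj₁ (other-slice-< S (λ ()) |S|≤d ne₀)))

EdgeRemoval : ℕ → Set
EdgeRemoval d = ∀ (S : List (Vertex d)) {u v} → u ∈ S → v ∈ S → Adj u v →
                length S ≤ d → Connected S

-- Inductive step when the removed edge lies inside layer x: that layer is
-- handled by the induction hypothesis, the other one removes fewer than d.
edge-within-layer : ∀ {d} → EdgeRemoval d → (S : List (Vertex (suc d))) (x : Bool) → ∀ {u v} →
                    (x ∷ u) ∈ S → (x ∷ v) ∈ S → Adj u v → length S ≤ suc d → Connected S
edge-within-layer {d} ih S x xu∈S xv∈S u~v |S|≤ with empty-or-nonempty (slice (not x) S)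
... | inj₁ empty    = connected-via-free-layer S (not x) empty
... | inj₂ other≥1 =
  connected-via-halves S (every-bit x≢x′ layer-x layer-x′)
    (room-for-column (slices-lower S x≢x′ two≤ other≥1) |S|≤)
  where
  x≢x′ : x ≢ not x
  x≢x′ = not-¬ refl
  two≤ : 2 ≤ length (slice x S)
  two≤ = two-members (∈-slice⁺ x S xu∈S) (∈-slice⁺ x S xv∈S) (adj-irrefl u~v)
  layer-x : Connected (slice x S)
  layer-x = ih _ (∈-slice⁺ x S xu∈S) (∈-slice⁺ x S xv∈S) u~v
               (≤-pred (other-slice-< S x≢x′ |S|≤ other≥1))
  layer-x′ : Connected (slice (not x) S)
  layer-x′ = small-removal-connected d _ (inj₁ (other-slice-< S (≢-sym x≢x′) |S|≤ two≤))

-- Inductive step when the removed edge joins x ∷ u and y ∷ u: u lies in both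
-- slices, so a slice of size at most one lies in every slice; otherwise both
-- slices have at least two elements and the other slice removes fewer than d.
edge-across-layers : ∀ {d} (S : List (Vertex (suc d))) {x y : Bool} (u : Vertex d) → x ≢ y →
                     (x ∷ u) ∈ S → (y ∷ u) ∈ S → length S ≤ suc d → Connected S
edge-across-layers {d} S {x} {y} u x≢y xu∈S yu∈S |S|≤ =
  by-slice-sizes (length (slice x S) ≤? 1) (length (slice y S) ≤? 1)
  where
  u-everywhere : ∀ z → u ∈ slice z S
  u-everywhere = every-bit x≢y (∈-slice⁺ x S xu∈S) (∈-slice⁺ y S yu∈S)
  funnel : ∀ z → length (slice z S) ≤ 1 → ∀ z′ {v} → v ∈ slice z S → v ∈ slice z′ S
  funnel z ≤1 z′ v∈ =
    subst (_∈ slice z′ S) (sym (at-most-one ≤1 (u-everywhere z) v∈)) (u-everywhere z′)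
  by-slice-sizes : Dec (length (slice x S) ≤ 1) → Dec (length (slice y S) ≤ 1) → Connected S
  by-slice-sizes (yes ≤1) _ =
    connected-via-layer S x (small-removal-connected d _ (inj₂ ≤1)) (funnel x ≤1)
  by-slice-sizes (no _) (yes ≤1) =
    connected-via-layer S y (small-removal-connected d _ (inj₂ ≤1)) (funnel y ≤1)
  by-slice-sizes (no big-x) (no big-y) =
    connected-via-halves S
      (every-bit x≢y
        (small-removal-connected d _ (inj₁ (other-slice-< S x≢y |S|≤ (≰⇒> big-y))))
        (small-removal-connected d _ (inj₁ (other-slice-< S (≢-sym x≢y) |S|≤ (≰⇒> big-x)))))
      (room-for-column (≤-trans (n≤1+n 3) (slices-lower S x≢y (≰⇒> big-x) (≰⇒> big-y))) |S|≤)

edge-removal-connected : ∀ d → EdgeRemoval d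
edge-removal-connected zero S {u} {v} _ _ u~v _ = ⊥-elim (no-edges-in-Q₀ {u} {v} u~v)
edge-removal-connected (suc d) S {x ∷ u} {y ∷ v} xu∈S yv∈S xu~yv |S|≤ with adj-cases xu~yv
... | inj₁ (refl , u~v) = edge-within-layer (edge-removal-connected d) S x xu∈S yv∈S u~v |S|≤
... | inj₂ (x≢y , refl) = edge-across-layers S u x≢y xu∈S yv∈S |S|≤

-- From walks to paths

path-suffix : ∀ {d} {P : Vertex d → Set} {a c b : Vertex d} {vs} →
              WalkFrom c b vs → Unique vs → All P vs → a ∈ vs →
              ∃ λ ws → IsPath a b ws × All P ws
path-suffix (single c) u ps (here refl) = _ , (single c , u) , ps
path-suffix (step c~e w) u ps (here refl) = _ , (step c~e w , u) , ps
path-suffix (step _ w) (_ ∷ u) (_ ∷ ps) (there a∈) = path-suffix w u ps a∈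

-- Loop erasure: a walk avoiding S yields a path avoiding S.
reach→path : ∀ {d} {S : List (Vertex d)} {a b} → Reach S a b → a ∉ S →
             ∃ λ vs → IsPath a b vs × All (_∉ S) vs
reach→path (stay a) a∉S = _ , (single a , [] ∷ []) , a∉S ∷ []
reach→path (move {a} a~c c∉S r) a∉S with reach→path r c∉S
... | vs , (w , u) , avoid with DecMembership._∈?_ (≡-dec Bool._≟_) a vs
...   | yes a∈ = path-suffix w u avoid a∈
...   | no a∉  = a ∷ vs , (step a~c w , ¬Any⇒All¬ vs a∉ ∷ u) , a∉S ∷ avoid

corollary17 : (d : ℕ) → d ≥ 1 → (S : List (Vertex d)) → Unique S →
    length S ≡ d → IsSeparator S → IsIndependent S
corollary17 d _ S _ |S|≡d (a , b , a∉S , b∉S , separates) u∈S v∈S u~v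
  with reach→path (edge-removal-connected d S u∈S v∈S u~v (≤-reflexive |S|≡d) a∉S b∉S) a∉S
... | vs , path , avoid = All¬⇒¬Any avoid (separates vs path)
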